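{- Let $G$ be a connected finite simple graph. If $G$ has a cut-vertex, then $\alpha^*(G)\geq 2$.
   Context: An independent set $I$ of $G$ means a nonempty set of pairwise non-adjacent vertices; $w_G(I)=\sum_{u\in I}d_G(u)$; $I$ is light if $w_G(I)\le |V(G)|-1$. $\alpha^*(G)=\max\{|I|: I\text{ a light independent set of }G\}$. -}

module Defs where

open import Data.Nat using (ℕ; _+_; _∸_; _≤_)
open import Data.Bool using (Bool; true; false; if_then_else_)
open import Data.Fin using (Fin)
open import Data.Fin.Subset using (Subset; _∈_; ∣_∣; Nonempty)
open import Data.Vec using (tabulate; lookup; sum)
open import Data.Unit using (⊤)
open import Data.Product using (Σ; _×_; ∃; ∃-syntax)
open import Relation.Nullary using (¬_)
open import Relation.Binary.PropositionalEquality using (_≡_; _≢_)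

record Graph (n : ℕ) : Set where
  field
    adj    : Fin n → Fin n → Bool
    sym    : ∀ u v → adj u v ≡ adj v u
    irrefl : ∀ u → adj u u ≡ false
open Graph public

module _ {n : ℕ} (G : Graph n) where

  N : Fin n → Subset n
  N v = tabulate (adj G v)

  deg : Fin n → ℕ
  deg v = ∣ N v ∣

  data Walk (P : Fin n → Set) : Fin n → Fin n → Set where
    here : ∀ {x} → P x → Walk P x x
    step : ∀ {x y z} → P x → adj G x y ≡ true → Walk P y z → Walk P x z

  Connected : Set
  Connected = ∀ x y → Walk (λ _ → ⊤) x y

  -- v is a cut-vertex: G - v is disconnected, i.e. some two vertices
  -- other than v are not joined by a walk avoiding v
  CutVertex : Fin n → Set
  CutVertex v = ∃[ x ] ∃[ y ] (x ≢ v × y ≢ v × ¬ Walk (λ z → z ≢ v) x y)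

  IndependentSet : Subset n → Set
  IndependentSet I = Nonempty I × (∀ u w → u ∈ I → w ∈ I → adj G u w ≡ false)

  weight : Subset n → ℕ
  weight I = sum (tabulate (λ u → if lookup I u then deg u else 0))

  Light : Subset n → Set
  Light I = IndependentSet I × weight I ≤ n ∸ 1

  -- "α*(G) ≥ k": some light independent set has at least k vertices
  -- (α*(G) is the maximum size of a light independent set)
  αStar≥ : ℕ → Set
  αStar≥ k = ∃[ I ] (Light I × k ≤ ∣ I ∣)

{-# OPTIONS --safe #-}
module Submission where

-- Let v be a cut-vertex and x, y vertices in different components of G − v.
-- Then x and y are non-adjacent, neither lies in N(x) ∪ N(y), and v is their
-- only possible common neighbour, so by inclusion–exclusion
--   d(x) + d(y) = |N(x) ∪ N(y)| + |N(x) ∩ N(y)| ≤ (n − 2) + 1,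
-- making {x, y} a light independent set.

open import Defs hiding (sym)
open import Data.Bool using (Bool; true; false; if_then_else_; _∨_)
open import Data.Bool.Properties using (not-¬; ¬-not)
open import Data.Fin using (Fin; zero; suc; _≟_)
open import Data.Fin.Subset
  using (Subset; _∈_; _⊆_; ⁅_⁆; _∪_; _∩_; ⊥; ∣_∣; Empty)
open import Data.Fin.Subset.Properties
  using (x∈⁅x⁆; x∈⁅y⁆⇒x≡y; ∣⁅x⁆∣≡1; ∣⊥∣≡0; ∣p∣≤n; p⊆q⇒∣p∣≤∣q∣; Empty-unique;
         x∈p∪q⁺; x∈p∪q⁻; x∈p∩q⁻)
open import Data.Nat using (ℕ; zero; suc; _+_; _∸_; _≤_; _<_; pred; z≤n)
open import Data.Nat.Properties
  using (+-suc; +-identityʳ; +-mono-≤; +-monoʳ-≤; +-monoʳ-<; n<1+n; m≤m+n; ≤-refl; ≤-reflexive;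
         suc[m]≤n⇒m≤pred[n]; pred[m∸n]≡m∸[1+n]; +-commutativeSemigroup; module ≤-Reasoning)
open import Algebra.Properties.CommutativeSemigroup +-commutativeSemigroup using (interchange)
open import Data.Product using (_,_; ∃-syntax)
open import Data.Sum using (_⊎_; inj₁; inj₂)
open import Data.Vec using (_∷_; []; tabulate; lookup; sum)
open import Data.Vec.Properties using (lookup∘tabulate; []=⇒lookup)
open import Relation.Binary.PropositionalEquality
  using (_≡_; _≢_; refl; sym; trans; cong; cong₂; module ≡-Reasoning)
open import Relation.Nullary using (¬_; yes; no; contradiction)

private
  variable
    n : ℕ

∣p∪q∣+∣p∩q∣≡∣p∣+∣q∣ : ∀ (p q : Subset n) → ∣ p ∪ q ∣ + ∣ p ∩ q ∣ ≡ ∣ p ∣ + ∣ q ∣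
∣p∪q∣+∣p∩q∣≡∣p∣+∣q∣ []         []         = refl
∣p∪q∣+∣p∩q∣≡∣p∣+∣q∣ (true ∷ p)  (true ∷ q)  = cong suc (begin
  ∣ p ∪ q ∣ + suc ∣ p ∩ q ∣   ≡⟨ +-suc _ _ ⟩
  suc (∣ p ∪ q ∣ + ∣ p ∩ q ∣) ≡⟨ cong suc (∣p∪q∣+∣p∩q∣≡∣p∣+∣q∣ p q) ⟩
  suc (∣ p ∣ + ∣ q ∣)         ≡⟨ sym (+-suc _ _) ⟩
  ∣ p ∣ + suc ∣ q ∣           ∎)
  where open ≡-Reasoning
∣p∪q∣+∣p∩q∣≡∣p∣+∣q∣ (true ∷ p)  (false ∷ q) = cong suc (∣p∪q∣+∣p∩q∣≡∣p∣+∣q∣ p q)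
∣p∪q∣+∣p∩q∣≡∣p∣+∣q∣ (false ∷ p) (true ∷ q)  =
  trans (cong suc (∣p∪q∣+∣p∩q∣≡∣p∣+∣q∣ p q)) (sym (+-suc _ _))
∣p∪q∣+∣p∩q∣≡∣p∣+∣q∣ (false ∷ p) (false ∷ q) = ∣p∪q∣+∣p∩q∣≡∣p∣+∣q∣ p q

∣p∪q∣≡∣p∣+∣q∣ : ∀ (p q : Subset n) → Empty (p ∩ q) → ∣ p ∪ q ∣ ≡ ∣ p ∣ + ∣ q ∣
∣p∪q∣≡∣p∣+∣q∣ {n} p q disjoint = begin
  ∣ p ∪ q ∣               ≡⟨ sym (+-identityʳ _) ⟩
  ∣ p ∪ q ∣ + 0           ≡⟨ cong (∣ p ∪ q ∣ +_) (sym (∣⊥∣≡0 n)) ⟩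
  ∣ p ∪ q ∣ + ∣ ⊥ {n} ∣   ≡⟨ cong (λ r → ∣ p ∪ q ∣ + ∣ r ∣) (sym (Empty-unique disjoint)) ⟩
  ∣ p ∪ q ∣ + ∣ p ∩ q ∣   ≡⟨ ∣p∪q∣+∣p∩q∣≡∣p∣+∣q∣ p q ⟩
  ∣ p ∣ + ∣ q ∣           ∎
  where open ≡-Reasoning

x∈⁅y⁆∪⁅z⁆⁻ : ∀ {x y z : Fin n} → x ∈ ⁅ y ⁆ ∪ ⁅ z ⁆ → x ≡ y ⊎ x ≡ z
x∈⁅y⁆∪⁅z⁆⁻ {y = y} {z} x∈ with x∈p∪q⁻ ⁅ y ⁆ ⁅ z ⁆ x∈
... | inj₁ x∈⁅y⁆ = inj₁ (x∈⁅y⁆⇒x≡y y x∈⁅y⁆)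
... | inj₂ x∈⁅z⁆ = inj₂ (x∈⁅y⁆⇒x≡y z x∈⁅z⁆)

∣⁅x⁆∪⁅y⁆∣≡2 : ∀ {x y : Fin n} → x ≢ y → ∣ ⁅ x ⁆ ∪ ⁅ y ⁆ ∣ ≡ 2
∣⁅x⁆∪⁅y⁆∣≡2 {x = x} {y} x≢y = begin
  ∣ ⁅ x ⁆ ∪ ⁅ y ⁆ ∣       ≡⟨ ∣p∪q∣≡∣p∣+∣q∣ ⁅ x ⁆ ⁅ y ⁆ disjoint ⟩
  ∣ ⁅ x ⁆ ∣ + ∣ ⁅ y ⁆ ∣   ≡⟨ cong₂ _+_ (∣⁅x⁆∣≡1 x) (∣⁅x⁆∣≡1 y) ⟩
  2                       ∎
  where
  open ≡-Reasoning
  disjoint : Empty (⁅ x ⁆ ∩ ⁅ y ⁆)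
  disjoint (u , u∈) with x∈p∩q⁻ ⁅ x ⁆ ⁅ y ⁆ u∈
  ... | u∈⁅x⁆ , u∈⁅y⁆ = x≢y (trans (sym (x∈⁅y⁆⇒x≡y x u∈⁅x⁆)) (x∈⁅y⁆⇒x≡y y u∈⁅y⁆))

-- weight G is definitionally sumOver (deg G).
sumOver : (Fin n → ℕ) → Subset n → ℕ
sumOver f p = sum (tabulate λ u → if lookup p u then f u else 0)

sumOver-⊥ : ∀ (f : Fin n → ℕ) → sumOver f ⊥ ≡ 0
sumOver-⊥ {zero}  f = refl
sumOver-⊥ {suc n} f = sumOver-⊥ (λ u → f (suc u))

sumOver-⁅x⁆ : ∀ (f : Fin n → ℕ) (x : Fin n) → sumOver f ⁅ x ⁆ ≡ f x
sumOver-⁅x⁆ f zero    = trans (cong (f zero +_) (sumOver-⊥ (λ u → f (suc u)))) (+-identityʳ _)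
sumOver-⁅x⁆ f (suc x) = sumOver-⁅x⁆ (λ u → f (suc u)) x

sumOver-∪ : ∀ (f : Fin n → ℕ) (p q : Subset n) → sumOver f (p ∪ q) ≤ sumOver f p + sumOver f q
sumOver-∪ f []      []      = z≤n
sumOver-∪ f (a ∷ p) (b ∷ q) = begin
  term (a ∨ b) + sumOver f′ (p ∪ q)                    ≤⟨ +-mono-≤ (term-∨ a b) (sumOver-∪ f′ p q) ⟩
  (term a + term b) + (sumOver f′ p + sumOver f′ q)    ≡⟨ interchange (term a) (term b) _ _ ⟩
  (term a + sumOver f′ p) + (term b + sumOver f′ q)    ∎
  where
  open ≤-Reasoning
  f′ : Fin _ → ℕ
  f′ u = f (suc u)
  term : Bool → ℕ
  term c = if c then f zero else 0
  term-∨ : ∀ c d → term (c ∨ d) ≤ term c + term d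
  term-∨ true  true  = m≤m+n _ _
  term-∨ true  false = m≤m+n _ 0
  term-∨ false true  = ≤-refl
  term-∨ false false = z≤n

∈N⇒adj : ∀ (G : Graph n) {u v} → u ∈ N G v → adj G v u ≡ true
∈N⇒adj G {u} {v} u∈ = trans (sym (lookup∘tabulate (adj G v) u)) ([]=⇒lookup u∈)

module Separated (G : Graph n) {v x y : Fin n}
                 (x≢v : x ≢ v) (y≢v : y ≢ v) (noWalk : ¬ Walk G (λ z → z ≢ v) x y) where

  pair : Subset n
  pair = ⁅ x ⁆ ∪ ⁅ y ⁆

  x≢y : x ≢ y
  x≢y refl = noWalk (here y≢v)

  x≁y : adj G x y ≡ false
  x≁y = ¬-not λ x~y → noWalk (step x≢v x~y (here y≢v))

  pair-nonadjacent : ∀ u w → u ∈ pair → w ∈ pair → adj G u w ≡ false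
  pair-nonadjacent u w u∈ w∈ with x∈⁅y⁆∪⁅z⁆⁻ u∈ | x∈⁅y⁆∪⁅z⁆⁻ w∈
  ... | inj₁ refl | inj₁ refl = irrefl G u
  ... | inj₁ refl | inj₂ refl = x≁y
  ... | inj₂ refl | inj₁ refl = trans (Graph.sym G y x) x≁y
  ... | inj₂ refl | inj₂ refl = irrefl G u

  x∈pair : x ∈ pair
  x∈pair = x∈p∪q⁺ (inj₁ (x∈⁅x⁆ x))

  y∈pair : y ∈ pair
  y∈pair = x∈p∪q⁺ (inj₂ (x∈⁅x⁆ y))

  independent : IndependentSet G pair
  independent = (x , x∈pair) , pair-nonadjacent

  N∩N⊆⁅v⁆ : N G x ∩ N G y ⊆ ⁅ v ⁆
  N∩N⊆⁅v⁆ {u} u∈ with u ≟ v | x∈p∩q⁻ (N G x) (N G y) u∈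
  ... | yes refl | _ = x∈⁅x⁆ v
  ... | no u≢v | u∈Nx , u∈Ny =
    contradiction (step x≢v (∈N⇒adj G u∈Nx) (step u≢v u~y (here y≢v))) noWalk
    where
    u~y : adj G u y ≡ true
    u~y = trans (Graph.sym G u y) (∈N⇒adj G u∈Ny)

  N∪N : Subset n
  N∪N = N G x ∪ N G y

  N∪N∩pair-empty : Empty (N∪N ∩ pair)
  N∪N∩pair-empty (u , u∈) with x∈p∩q⁻ N∪N pair u∈
  ... | u∈N∪N , u∈pair with x∈p∪q⁻ (N G x) (N G y) u∈N∪N
  ...   | inj₁ u∈Nx = not-¬ (∈N⇒adj G u∈Nx) (pair-nonadjacent x u x∈pair u∈pair)
  ...   | inj₂ u∈Ny = not-¬ (∈N⇒adj G u∈Ny) (pair-nonadjacent y u y∈pair u∈pair)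

  deg+deg<n : deg G x + deg G y < n
  deg+deg<n = begin-strict
    deg G x + deg G y                 ≡⟨ sym (∣p∪q∣+∣p∩q∣≡∣p∣+∣q∣ (N G x) (N G y)) ⟩
    ∣ N∪N ∣ + ∣ N G x ∩ N G y ∣       ≤⟨ +-monoʳ-≤ ∣ N∪N ∣ (p⊆q⇒∣p∣≤∣q∣ N∩N⊆⁅v⁆) ⟩
    ∣ N∪N ∣ + ∣ ⁅ v ⁆ ∣               ≡⟨ cong (∣ N∪N ∣ +_) (∣⁅x⁆∣≡1 v) ⟩
    ∣ N∪N ∣ + 1                       <⟨ +-monoʳ-< ∣ N∪N ∣ (n<1+n 1) ⟩
    ∣ N∪N ∣ + 2                       ≡⟨ cong (∣ N∪N ∣ +_) (sym (∣⁅x⁆∪⁅y⁆∣≡2 x≢y)) ⟩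
    ∣ N∪N ∣ + ∣ pair ∣                ≡⟨ sym (∣p∪q∣≡∣p∣+∣q∣ N∪N pair N∪N∩pair-empty) ⟩
    ∣ N∪N ∪ pair ∣                    ≤⟨ ∣p∣≤n (N∪N ∪ pair) ⟩
    n                                 ∎
    where open ≤-Reasoning

  light : Light G pair
  light = independent , (begin
    weight G pair                                   ≤⟨ sumOver-∪ (deg G) ⁅ x ⁆ ⁅ y ⁆ ⟩
    sumOver (deg G) ⁅ x ⁆ + sumOver (deg G) ⁅ y ⁆   ≡⟨ cong₂ _+_ (sumOver-⁅x⁆ (deg G) x) (sumOver-⁅x⁆ (deg G) y) ⟩
    deg G x + deg G y                               ≤⟨ suc[m]≤n⇒m≤pred[n] deg+deg<n ⟩
    pred n                                          ≡⟨ pred[m∸n]≡m∸[1+n] n 0 ⟩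
    n ∸ 1                                           ∎)
    where open ≤-Reasoning

lemma3 : ∀ {n : ℕ} (G : Graph n) → Connected G → (∃[ v ] CutVertex G v) → αStar≥ G 2
lemma3 G _ (v , x , y , x≢v , y≢v , noWalk) = pair , light , ≤-reflexive (sym (∣⁅x⁆∪⁅y⁆∣≡2 x≢y))
  where open Separated G x≢v y≢v noWalk
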